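{- For every nonzero composition $\eta\in\mathbb{N}^n$, $(\Phi\eta)^*=\Phi(\eta^*)$, and for $1\le i\le n-1$, if $s_i\eta\ne\eta$ then $(s_i\eta)^*=s_i(\eta^*)$.
   Context: For a nonzero composition $\eta\in\mathbb{N}^n$ let $m=\max_i\eta_i$, $k=\min\{i:\eta_i=m\}$, and let $\eta^*$ be the composition obtained from $\eta$ by replacing $\eta_k$ by $m-1$ (deleting the critical box $(k,m)$). $\Phi\eta=(\eta_2,\dots,\eta_n,\eta_1+1)$; $s_i\eta$ is $\eta$ with entries $\eta_i,\eta_{i+1}$ swapped. -}

module Defs where

open import Data.Nat using (ℕ; zero; suc; _∸_; _⊔_)
open import Data.Nat.Properties using (_≟_)
open import Data.Vec using (Vec; []; _∷_; _∷ʳ_)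
open import Relation.Nullary using (yes; no)

-- A composition with n parts: a vector of n natural numbers (entries 1-indexed in the paper).

maxV : ∀ {n} → Vec ℕ n → ℕ
maxV []       = 0
maxV (x ∷ xs) = x ⊔ maxV xs

decFirst : ∀ {n} → ℕ → Vec ℕ n → Vec ℕ n
decFirst m []       = []
decFirst m (x ∷ xs) with x ≟ m
... | yes _ = (m ∸ 1) ∷ xs
... | no  _ = x ∷ decFirst m xs

-- η* : delete the critical box (k, m), k = min{i : η_i = m}
star : ∀ {n} → Vec ℕ n → Vec ℕ n
star η = decFirst (maxV η) η

Φ : ∀ {n} → Vec ℕ n → Vec ℕ n
Φ []       = []
Φ (x ∷ xs) = xs ∷ʳ suc x

-- s_i η : swap entries i and i+1 (1-indexed); identity when out of range
s : ∀ {n} → ℕ → Vec ℕ n → Vec ℕ n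
s (suc zero)    (x ∷ y ∷ xs) = y ∷ x ∷ xs
s (suc (suc i)) (x ∷ xs)     = x ∷ s (suc i) xs
s _             xs           = xs

{-# OPTIONS --safe #-}
-- If row 1 is a longest row, it becomes
-- the unique longest row of Φ η, and both sides remove its last box; otherwise the first
-- longest row of η stays the first longest row of Φ η.  A swap s_i η ≠ η never exchanges
-- two longest rows, so the first longest row is carried along by the swap.
module Submission where

open import Defs
open import Data.Nat using (ℕ; zero; suc; _≤_; _<_; _∸_; _⊔_; z≤n; s≤s)
open import Data.Nat.Properties
open import Data.Vec using (Vec; replicate; []; _∷_; _∷ʳ_)
open import Data.Vec.Relation.Unary.Any using (here; there)
open import Data.Vec.Membership.Propositional using (_∈_; _∉_)
open import Data.Product using (_×_; _,_)
open import Data.Sum using (inj₁; inj₂)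
open import Data.Empty using (⊥-elim)
open import Function using (_∘_)
open import Relation.Nullary using (yes; no)
open import Relation.Binary.PropositionalEquality
  using (_≡_; _≢_; refl; sym; trans; cong; cong₂; module ≡-Reasoning)

maxV-∷ʳ : ∀ {n} (xs : Vec ℕ n) (y : ℕ) → maxV (xs ∷ʳ y) ≡ maxV xs ⊔ y
maxV-∷ʳ []       y = ⊔-comm y 0
maxV-∷ʳ (x ∷ xs) y = trans (cong (x ⊔_) (maxV-∷ʳ xs y)) (sym (⊔-assoc x (maxV xs) y))

maxV-s : ∀ {n} (i : ℕ) (η : Vec ℕ n) → maxV (s i η) ≡ maxV η
maxV-s zero                η            = refl
maxV-s (suc zero)          []           = refl
maxV-s (suc zero)          (x ∷ [])     = refl
maxV-s (suc zero)          (x ∷ y ∷ xs) = begin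
  y ⊔ (x ⊔ maxV xs)  ≡⟨ sym (⊔-assoc y x (maxV xs)) ⟩
  (y ⊔ x) ⊔ maxV xs  ≡⟨ cong (_⊔ maxV xs) (⊔-comm y x) ⟩
  (x ⊔ y) ⊔ maxV xs  ≡⟨ ⊔-assoc x y (maxV xs) ⟩
  x ⊔ (y ⊔ maxV xs)  ∎
  where open ≡-Reasoning
maxV-s (suc (suc i)) []       = refl
maxV-s (suc (suc i)) (x ∷ xs) = cong (x ⊔_) (maxV-s (suc i) xs)

∈⇒≤maxV : ∀ {n} {m} {xs : Vec ℕ n} → m ∈ xs → m ≤ maxV xs
∈⇒≤maxV {xs = x ∷ xs} (here refl) = m≤m⊔n x (maxV xs)
∈⇒≤maxV {xs = x ∷ xs} (there m∈xs) = ≤-trans (∈⇒≤maxV m∈xs) (m≤n⊔m x (maxV xs))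

maxV-∈ : ∀ {n} (xs : Vec ℕ n) → 0 < maxV xs → maxV xs ∈ xs
maxV-∈ (x ∷ xs) pos with ⊔-sel x (maxV xs)
... | inj₁ x⊔≡x = here x⊔≡x
... | inj₂ x⊔≡m rewrite x⊔≡m = there (maxV-∈ xs pos)

maxV≡0⇒≡replicate : ∀ {n} (xs : Vec ℕ n) → maxV xs ≡ 0 → xs ≡ replicate n 0
maxV≡0⇒≡replicate []       _  = refl
maxV≡0⇒≡replicate (x ∷ xs) eq = cong₂ _∷_
  (n≤0⇒n≡0 (≤-trans (m≤m⊔n x (maxV xs)) (≤-reflexive eq)))
  (maxV≡0⇒≡replicate xs (n≤0⇒n≡0 (≤-trans (m≤n⊔m x (maxV xs)) (≤-reflexive eq))))

decFirst-hit : ∀ {n} (m : ℕ) (xs : Vec ℕ n) → decFirst m (m ∷ xs) ≡ (m ∸ 1) ∷ xs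
decFirst-hit m xs with m ≟ m
... | yes _   = refl
... | no m≢m = ⊥-elim (m≢m refl)

decFirst-miss : ∀ {n} {m x : ℕ} (xs : Vec ℕ n) → x ≢ m → decFirst m (x ∷ xs) ≡ x ∷ decFirst m xs
decFirst-miss {m = m} {x} xs x≢m with x ≟ m
... | yes x≡m = ⊥-elim (x≢m x≡m)
... | no _    = refl

decFirst-∷ʳ-∈ : ∀ {n} {m} (xs : Vec ℕ n) (y : ℕ) → m ∈ xs → decFirst m (xs ∷ʳ y) ≡ decFirst m xs ∷ʳ y
decFirst-∷ʳ-∈ {m = m} (x ∷ xs) y m∈ with x ≟ m | m∈
... | yes _   | _            = refl
... | no x≢m  | here m≡x     = ⊥-elim (x≢m (sym m≡x))
... | no _    | there m∈xs   = cong (x ∷_) (decFirst-∷ʳ-∈ xs y m∈xs)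

decFirst-∷ʳ-∉ : ∀ {n} {m} (xs : Vec ℕ n) → m ∉ xs → decFirst m (xs ∷ʳ m) ≡ xs ∷ʳ (m ∸ 1)
decFirst-∷ʳ-∉ {m = m} []       _  = decFirst-hit m []
decFirst-∷ʳ-∉ {m = m} (x ∷ xs) m∉ = trans
  (decFirst-miss (xs ∷ʳ m) (λ x≡m → m∉ (here (sym x≡m))))
  (cong (x ∷_) (decFirst-∷ʳ-∉ xs (m∉ ∘ there)))

decFirst-s : ∀ {n} (m i : ℕ) (η : Vec ℕ n) → s i η ≢ η → decFirst m (s i η) ≡ s i (decFirst m η)
decFirst-s m zero          η  nontriv = ⊥-elim (nontriv refl)
decFirst-s m (suc zero)    [] nontriv = ⊥-elim (nontriv refl)
decFirst-s m (suc zero)    (x ∷ []) nontriv = ⊥-elim (nontriv refl)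
decFirst-s m (suc zero)    (x ∷ y ∷ xs) nontriv with x ≟ m | y ≟ m
... | yes refl | yes refl = ⊥-elim (nontriv refl)
... | yes refl | no _     = cong (y ∷_) (decFirst-hit x xs)
... | no _     | yes refl = cong (s 1 ∘ (x ∷_)) (sym (decFirst-hit y xs))
... | no x≢m   | no y≢m   = trans (cong (y ∷_) (decFirst-miss xs x≢m))
                                  (cong (s 1 ∘ (x ∷_)) (sym (decFirst-miss xs y≢m)))
decFirst-s m (suc (suc i)) [] nontriv = ⊥-elim (nontriv refl)
decFirst-s m (suc (suc i)) (x ∷ xs) nontriv with x ≟ m
... | yes _ = refl
... | no _  = cong (x ∷_) (decFirst-s m (suc i) xs (nontriv ∘ cong (x ∷_)))

star-∷-≥ : ∀ {n} (x : ℕ) (xs : Vec ℕ n) → maxV xs ≤ x → star (x ∷ xs) ≡ (x ∸ 1) ∷ xs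
star-∷-≥ x xs le rewrite m≥n⇒m⊔n≡m le = decFirst-hit x xs

star-∷-< : ∀ {n} (x : ℕ) (xs : Vec ℕ n) → x < maxV xs → star (x ∷ xs) ≡ x ∷ star xs
star-∷-< x xs lt rewrite m≤n⇒m⊔n≡n (<⇒≤ lt) = decFirst-miss xs (<⇒≢ lt)

star-∷ʳ-> : ∀ {n} (xs : Vec ℕ n) (y : ℕ) → maxV xs < y → star (xs ∷ʳ y) ≡ xs ∷ʳ (y ∸ 1)
star-∷ʳ-> xs y lt rewrite maxV-∷ʳ xs y | m≤n⇒m⊔n≡n (<⇒≤ lt) =
  decFirst-∷ʳ-∉ xs (λ y∈ → <⇒≱ lt (∈⇒≤maxV y∈))

star-∷ʳ-≤ : ∀ {n} (xs : Vec ℕ n) (y : ℕ) → 0 < maxV xs → y ≤ maxV xs →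
            star (xs ∷ʳ y) ≡ star xs ∷ʳ y
star-∷ʳ-≤ xs y pos le rewrite maxV-∷ʳ xs y | m≥n⇒m⊔n≡m le =
  decFirst-∷ʳ-∈ xs y (maxV-∈ xs pos)

star-Φ : ∀ {n} (η : Vec ℕ n) → η ≢ replicate n 0 → star (Φ η) ≡ Φ (star η)
star-Φ []       nonzero = ⊥-elim (nonzero refl)
star-Φ (x ∷ xs) nonzero with maxV xs ≤? x
star-Φ (zero ∷ xs) nonzero | yes le =
  ⊥-elim (nonzero (cong (0 ∷_) (maxV≡0⇒≡replicate xs (n≤0⇒n≡0 le))))
star-Φ (suc x ∷ xs) nonzero | yes le
  rewrite star-∷-≥ (suc x) xs le = star-∷ʳ-> xs (suc (suc x)) (s≤s le)
star-Φ (x ∷ xs) nonzero | no x≱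
  rewrite star-∷-< x xs (≰⇒> x≱) = star-∷ʳ-≤ xs (suc x) (≤-<-trans z≤n (≰⇒> x≱)) (≰⇒> x≱)

star-s : ∀ {n} (i : ℕ) (η : Vec ℕ n) → s i η ≢ η → star (s i η) ≡ s i (star η)
star-s i η nontriv rewrite maxV-s i η = decFirst-s (maxV η) i η nontriv

corollary4p5 : ∀ (n : ℕ) (η : Vec ℕ n) → η ≢ replicate n 0 →
    (star (Φ η) ≡ Φ (star η))
    × (∀ (i : ℕ) → 1 ≤ i → i ≤ n ∸ 1 → s i η ≢ η → star (s i η) ≡ s i (star η))
corollary4p5 n η nonzero = star-Φ η nonzero , λ i _ _ → star-s i η
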